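{- Let $T$ be a tournament with a fixed vertex ordering $\sigma$, let $S\subseteq V(T)$, and let $P_\sigma=(V_1,\ldots,V_\ell)$ be an ordered partition of $T_\sigma$. If $P_\sigma$ is an $S$-safe partition, then $$\mathrm{Sfas}(T) = \mathrm{Sfas}\big(T[A_I(T_\sigma,P_\sigma)]\big)+\mathrm{Sfas}\big(T[A_B(T_\sigma,P_\sigma)]\big).$$ Moreover, there exists a minimum-size $S$-feedback arc set of $T$ containing $B_E$, the set of all backward arcs in $A_B(T_\sigma,P_\sigma)$.
   Context: A tournament is a directed graph with exactly one arc between every pair of distinct vertices. $T_\sigma$ denotes $T$ with vertices ordered as $\sigma=v_1,\ldots,v_n$; an arc $(v_i,v_j)$ is backward if $i>j$ and forward otherwise. An ordered partition $P_\sigma=(V_1,\ldots,V_\ell)$ is a partition of $V(T)$ into sets of consecutive vertices of $\sigma$ such that every vertex of $V_i$ precedes every vertex of $V_j$ in $\sigma$ whenever $i<j$. $A_B(T_\sigma,P_\sigma)$ is the set of arcs whose endpoints lie in different parts, and $A_I(T_\sigma,P_\sigma)=A(T)\setminus A_B(T_\sigma,P_\sigma)$. An $S$-path is a directed path containing at least one vertex of $S$; an $S$-cycle is a directed cycle containing at least one vertex of $S$. A certificate of a backward arc $f=(v,u)$ is a directed $S$-path from $u$ to $v$ using only forward arcs of $A_B(T_\sigma,P_\sigma)$. $P_\sigma$ is $S$-safe if there is a collection of pairwise arc-disjoint certificates, one for each arc in $B_E$ (the set of backward arcs in $A_B(T_\sigma,P_\sigma)$). For a digraph $D$, $\mathrm{Sfas}(D)$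 is the minimum size of an arc set whose removal makes $D$ contain no $S$-cycle (an $S$-feedback arc set); for $A'\subseteq A(T)$, $T[A']$ denotes the digraph $(V(T),A')$. -}

module Defs where

open import Data.Nat using (ℕ; zero; suc; _+_; _≤_)
open import Data.Bool using (Bool; true; false; _∧_; not; if_then_else_)
open import Data.Fin using (Fin; zero; suc) renaming (_<_ to _<ᶠ_; _≤_ to _≤ᶠ_)
open import Data.Fin.Properties using (_≟_; _<?_)
open import Data.Fin.Subset using (Subset; _∈_)
open import Data.Fin.Permutation using (Permutation′; _⟨$⟩ʳ_)
open import Data.List using (List; []; _∷_; _++_)
open import Data.List.Relation.Unary.Any using (Any)
open import Data.List.Relation.Unary.Unique.Propositional using (Unique)
open import Data.Product using (Σ; ∃; _×_; _,_)
open import Data.Unit using (⊤)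
open import Data.Empty using (⊥)
open import Relation.Nullary using (¬_)
open import Relation.Nullary.Decidable using (⌊_⌋)
open import Relation.Binary.PropositionalEquality using (_≡_; _≢_)

-- Digraphs on vertex set Fin n (no multiple arcs): adjacency as Bool
-- matrix.  An arc set A' ⊆ Fin n × Fin n is also such a matrix; the
-- digraph T[A'] = (V(T), A') is then A' itself.

Digraph : ℕ → Set
Digraph n = Fin n → Fin n → Bool

ArcSet : ℕ → Set
ArcSet = Digraph

_⊆ᴬ_ : ∀ {n} → ArcSet n → Digraph n → Set
F ⊆ᴬ D = ∀ u v → F u v ≡ true → D u v ≡ true

_∖ᴬ_ : ∀ {n} → Digraph n → ArcSet n → Digraph n
(D ∖ᴬ F) u v = D u v ∧ not (F u v)

countB : ∀ {m} → (Fin m → Bool) → ℕ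
countB {zero} f = 0
countB {suc m} f = (if f zero then 1 else 0) + countB (λ i → f (suc i))

sumFin : ∀ {m} → (Fin m → ℕ) → ℕ
sumFin {zero} f = 0
sumFin {suc m} f = f zero + sumFin (λ i → f (suc i))

size : ∀ {n} → ArcSet n → ℕ
size F = sumFin (λ u → countB (F u))

record Tournament (n : ℕ) : Set where
  field
    adj    : Digraph n
    irrefl : ∀ v → adj v v ≡ false
    tourn  : ∀ u v → u ≢ v → adj u v ≡ not (adj v u)
open Tournament public

Consec : ∀ {n} → Digraph n → List (Fin n) → Set
Consec D [] = ⊤
Consec D (x ∷ []) = ⊤
Consec D (x ∷ y ∷ xs) = (D x y ≡ true) × Consec D (y ∷ xs)

ArcOf : ∀ {n} → Fin n → Fin n → List (Fin n) → Set
ArcOf a b [] = ⊥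
ArcOf a b (x ∷ []) = ⊥
ArcOf a b (x ∷ y ∷ xs) = ((a ≡ x) × (b ≡ y)) Data.Sum.⊎ ArcOf a b (y ∷ xs)
  where import Data.Sum

IsCycle : ∀ {n} → Digraph n → Fin n → List (Fin n) → Set
IsCycle D x xs = Unique (x ∷ xs) × Consec D ((x ∷ xs) ++ (x ∷ []))

IsSCycle : ∀ {n} → Subset n → Digraph n → Fin n → List (Fin n) → Set
IsSCycle S D x xs = IsCycle D x xs × Any (_∈ S) (x ∷ xs)

IsSPath : ∀ {n} → Subset n → Digraph n → Fin n → Fin n → List (Fin n) → Set
IsSPath S D u v mid =
  Unique (u ∷ mid ++ (v ∷ [])) × Consec D (u ∷ mid ++ (v ∷ []))
  × Any (_∈ S) (u ∷ mid ++ (v ∷ []))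

IsSFAS : ∀ {n} → Subset n → Digraph n → ArcSet n → Set
IsSFAS S D F = F ⊆ᴬ D × (∀ x xs → ¬ IsSCycle S (D ∖ᴬ F) x xs)

IsMinSFAS : ∀ {n} → Subset n → Digraph n → ArcSet n → Set
IsMinSFAS S D F = IsSFAS S D F × (∀ F′ → IsSFAS S D F′ → size F ≤ size F′)

SfasIs : ∀ {n} → Subset n → Digraph n → ℕ → Set
SfasIs S D k = Σ (ArcSet _) λ F → IsMinSFAS S D F × size F ≡ k

-- Orderings and ordered partitions.
-- σ : Permutation′ n, σ ⟨$⟩ʳ v is the position of v in σ (v = v_{pos+1}).

pos : ∀ {n} → Permutation′ n → Fin n → Fin n
pos σ v = σ ⟨$⟩ʳ v

-- ordered partition (V_1,…,V_ℓ) of T_σ: part v = index of the part of v;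
-- parts are nonempty and consist of consecutive vertices in order.
record OrderedPartition {n : ℕ} (σ : Permutation′ n) (ℓ : ℕ) : Set where
  field
    part     : Fin n → Fin ℓ
    nonempty : ∀ i → ∃ λ v → part v ≡ i
    ordered  : ∀ u v → pos σ u ≤ᶠ pos σ v → part u ≤ᶠ part v
open OrderedPartition public

module _ {n ℓ : ℕ} (T : Tournament n) (σ : Permutation′ n)
         (P : OrderedPartition σ ℓ) where

  AB : ArcSet n
  AB u v = adj T u v ∧ not ⌊ part P u ≟ part P v ⌋

  AI : ArcSet n
  AI u v = adj T u v ∧ ⌊ part P u ≟ part P v ⌋

  ABforward : ArcSet n
  ABforward u v = AB u v ∧ ⌊ pos σ u <? pos σ v ⌋

  BE : Fin n → Fin n → Set
  BE v u = (AB v u ≡ true) × (pos σ u <ᶠ pos σ v)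

  IsCertificate : Subset n → (v u : Fin n) → List (Fin n) → Set
  IsCertificate S v u mid = IsSPath S ABforward u v mid

  SSafe : Subset n → Set
  SSafe S =
    Σ ((v u : Fin n) → BE v u → List (Fin n)) λ cert →
      (∀ v u (f : BE v u) → IsCertificate S v u (cert v u f))
      × (∀ v u v′ u′ (f : BE v u) (f′ : BE v′ u′) →
           ¬ (v ≡ v′ × u ≡ u′) →
           ∀ a b → ArcOf a b (u ∷ cert v u f ++ (v ∷ []))
                 → ¬ ArcOf a b (u′ ∷ cert v′ u′ f′ ++ (v′ ∷ [])))

-- Removing from T a minimum S-feedback arc
-- set F_I of T[A_I] together with B_E destroys every S-cycle: the arcs left between parts
-- are forward, so a cycle cannot leave its part and would be an S-cycle of T[A_I] − F_I.
-- Conversely, an S-feedback arc set F of T restricts to S-feedback arc sets of T[A_I] and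
-- of T[A_B], and every S-feedback arc set of T[A_B] has at least |B_E| arcs: a backward arc
-- closes its certificate into an S-cycle of T[A_B], which must be hit, and since the
-- certificates are arc-disjoint and consist of forward arcs, distinct backward arcs are hit
-- in distinct arcs. Hence Sfas(T) ≤ Sfas(T[A_I]) + |B_E| ≤ Sfas(T[A_I]) + Sfas(T[A_B]) ≤ Sfas(T),
-- and F_I ∪ B_E is a minimum S-feedback arc set.
module Submission where

open import Defs
open import Data.Bool using (Bool; true; false; _∧_; _∨_; not; if_then_else_)
import Data.Bool.Properties as Bool
open import Data.Empty using (⊥-elim)
open import Data.Fin using (Fin; zero; suc; combine; remQuot) renaming (_≤_ to _≤ᶠ_; _<_ to _<ᶠ_)
open import Data.Fin.Permutation using (Permutation′)
open import Data.Fin.Properties using (_≟_; any?; all?; pigeonhole; remQuot-combine; <-asym)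
  renaming (_<?_ to _<ᶠ?_; ≤-reflexive to ≤ᶠ-reflexive; ≤-trans to ≤ᶠ-trans; ≤-antisym to ≤ᶠ-antisym)
open import Data.Fin.Subset using (Subset)
open import Data.Fin.Subset.Properties using (_∈?_; anySubset?)
open import Data.List using (List; []; _∷_; _++_; length)
import Data.List as List
open import Data.List.Membership.Propositional.Properties using (∈-lookup)
import Data.List.Relation.Unary.All as All
open import Data.List.Relation.Unary.AllPairs using (AllPairs; _∷_)
import Data.List.Relation.Unary.Any as Any
open import Data.List.Relation.Unary.Unique.Propositional using (Unique)
import Data.List.Relation.Unary.Unique.DecPropositional as UniqueDec
open import Data.Nat using (ℕ; zero; suc; _+_; _*_; _≤_; _<_; z≤n; s≤s; _≤?_; _<?_)
open import Data.Nat.Induction using (<-wellFounded)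
open import Data.Nat.Properties
  using ( 0≢1+n; suc-injective; ≤-refl; ≤-reflexive; ≤-trans; ≤-antisym; +-mono-≤; +-monoʳ-≤; +-suc
        ; n≤1+n; ≰⇒>; ≮⇒≥; +-commutativeSemigroup)
open import Algebra.Properties.CommutativeSemigroup +-commutativeSemigroup using (interchange)
open import Data.Product using (Σ; ∃; _×_; _,_; proj₁; proj₂; uncurry)
open import Data.Product.Properties using (≡-dec)
open import Data.Sum using (_⊎_; inj₁; inj₂)
open import Data.Unit using (tt)
open import Data.Vec using (lookup; tabulate)
open import Data.Vec.Properties using (lookup∘tabulate)
open import Function using (_∘_)
open import Induction.WellFounded using (Acc; acc)
open import Relation.Binary.PropositionalEquality
  using (_≡_; _≢_; refl; sym; trans; cong; cong₂; subst; subst₂; module ≡-Reasoning)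
open import Relation.Nullary using (¬_; Dec; yes; no; ¬?)
open import Relation.Nullary.Decidable using (⌊_⌋; map′; _×-dec_; _→-dec_)

⌊⌋-true : ∀ {A : Set} (d : Dec A) → ⌊ d ⌋ ≡ true → A
⌊⌋-true (yes a) _ = a

⌊⌋-yes : ∀ {A : Set} (d : Dec A) → A → ⌊ d ⌋ ≡ true
⌊⌋-yes (yes _) _ = refl
⌊⌋-yes (no ¬a) a = ⊥-elim (¬a a)

⌊⌋-no : ∀ {A : Set} (d : Dec A) → ¬ A → ⌊ d ⌋ ≡ false
⌊⌋-no (yes a) ¬a = ⊥-elim (¬a a)
⌊⌋-no (no _)  _  = refl

∧-not-∨ : ∀ x y z → x ∧ not (y ∨ z) ≡ true → x ≡ true × y ≡ false × z ≡ false
∧-not-∨ true false false _ = refl , refl , refl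

indicator : Bool → ℕ
indicator b = if b then 1 else 0

sumFin-cong : ∀ {m} {f g : Fin m → ℕ} → (∀ i → f i ≡ g i) → sumFin f ≡ sumFin g
sumFin-cong {zero}  f≗g = refl
sumFin-cong {suc m} f≗g = cong₂ _+_ (f≗g zero) (sumFin-cong (λ i → f≗g (suc i)))

sumFin-mono : ∀ {m} {f g : Fin m → ℕ} → (∀ i → f i ≤ g i) → sumFin f ≤ sumFin g
sumFin-mono {zero}  f≤g = z≤n
sumFin-mono {suc m} f≤g = +-mono-≤ (f≤g zero) (sumFin-mono (λ i → f≤g (suc i)))

sumFin-+ : ∀ {m} (f g : Fin m → ℕ) → sumFin (λ i → f i + g i) ≡ sumFin f + sumFin g
sumFin-+ {zero}  f g = refl
sumFin-+ {suc m} f g = trans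
  (cong (f zero + g zero +_) (sumFin-+ (λ i → f (suc i)) (λ i → g (suc i))))
  (interchange (f zero) (g zero) _ _)

sumFin-zero : ∀ {m} {f : Fin m → ℕ} → (∀ i → f i ≡ 0) → sumFin f ≡ 0
sumFin-zero {zero}  f≡0 = refl
sumFin-zero {suc m} f≡0 = cong₂ _+_ (f≡0 zero) (sumFin-zero (λ i → f≡0 (suc i)))

sumFin-decrement : ∀ {m} {f g : Fin m → ℕ} (a : Fin m) →
  f a ≡ suc (g a) → (∀ i → i ≢ a → f i ≡ g i) → sumFin f ≡ suc (sumFin g)
sumFin-decrement {suc m} zero fa≡ f≗g =
  cong₂ _+_ fa≡ (sumFin-cong (λ i → f≗g (suc i) (λ ())))
sumFin-decrement {suc m} {f} {g} (suc a) fa≡ f≗g = begin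
  f zero + sumFin (λ i → f (suc i))  ≡⟨ cong₂ _+_ (f≗g zero (λ ())) rest ⟩
  g zero + suc (sumFin (λ i → g (suc i))) ≡⟨ +-suc (g zero) _ ⟩
  suc (sumFin g) ∎
  where
  open ≡-Reasoning
  rest : sumFin (λ i → f (suc i)) ≡ suc (sumFin (λ i → g (suc i)))
  rest = sumFin-decrement a fa≡ (λ i i≢a → f≗g (suc i) (λ { refl → i≢a refl }))

countB≡sumFin : ∀ {m} (f : Fin m → Bool) → countB f ≡ sumFin (λ i → indicator (f i))
countB≡sumFin {zero}  f = refl
countB≡sumFin {suc m} f = cong (indicator (f zero) +_) (countB≡sumFin (λ i → f (suc i)))

rowSize : ∀ {n} → ArcSet n → Fin n → ℕ
rowSize F u = sumFin (λ v → indicator (F u v))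

size≡sumFin : ∀ {n} (F : ArcSet n) → size F ≡ sumFin (rowSize F)
size≡sumFin F = sumFin-cong (λ u → countB≡sumFin (F u))

size-cong : ∀ {n} {F G : ArcSet n} → (∀ u v → F u v ≡ G u v) → size F ≡ size G
size-cong {F = F} {G} F≗G = begin
  size F              ≡⟨ size≡sumFin F ⟩
  sumFin (rowSize F)  ≡⟨ sumFin-cong (λ u → sumFin-cong (λ v → cong indicator (F≗G u v))) ⟩
  sumFin (rowSize G)  ≡⟨ sym (size≡sumFin G) ⟩
  size G              ∎
  where open ≡-Reasoning

size-+ : ∀ {n} (F G : ArcSet n) →
  size F + size G ≡ sumFin (λ u → sumFin (λ v → indicator (F u v) + indicator (G u v)))
size-+ F G = begin
  size F + size G                          ≡⟨ cong₂ _+_ (size≡sumFin F) (size≡sumFin G) ⟩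
  sumFin (rowSize F) + sumFin (rowSize G)  ≡⟨ sym (sumFin-+ (rowSize F) (rowSize G)) ⟩
  sumFin (λ u → rowSize F u + rowSize G u)
    ≡⟨ sumFin-cong (λ u → sym (sumFin-+ (λ v → indicator (F u v)) (λ v → indicator (G u v)))) ⟩
  sumFin (λ u → sumFin (λ v → indicator (F u v) + indicator (G u v))) ∎
  where open ≡-Reasoning

size-≤-+ : ∀ {n} {F G H : ArcSet n} →
  (∀ u v → indicator (F u v) ≤ indicator (G u v) + indicator (H u v)) → size F ≤ size G + size H
size-≤-+ {F = F} {G} {H} pointwise = ≤-trans
  (≤-reflexive (size≡sumFin F))
  (≤-trans (sumFin-mono (λ u → sumFin-mono (pointwise u))) (≤-reflexive (sym (size-+ G H))))

size-+-≤ : ∀ {n} {F G H : ArcSet n} →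
  (∀ u v → indicator (G u v) + indicator (H u v) ≤ indicator (F u v)) → size G + size H ≤ size F
size-+-≤ {F = F} {G} {H} pointwise = ≤-trans
  (≤-reflexive (size-+ G H))
  (≤-trans (sumFin-mono (λ u → sumFin-mono (pointwise u))) (≤-reflexive (sym (size≡sumFin F))))

size-∨ : ∀ {n} (F G : ArcSet n) → size (λ u v → F u v ∨ G u v) ≤ size F + size G
size-∨ F G = size-≤-+ (λ u v → indicator-∨ (F u v) (G u v))
  where
  indicator-∨ : ∀ x y → indicator (x ∨ y) ≤ indicator x + indicator y
  indicator-∨ true  _ = s≤s z≤n
  indicator-∨ false y = ≤-reflexive refl

size-empty : ∀ {n} {F : ArcSet n} → ¬ (∃ λ a → ∃ λ b → F a b ≡ true) → size F ≡ 0
size-empty {F = F} empty = trans (size≡sumFin F) (sumFin-zero (λ u → sumFin-zero (λ v → absent u v)))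
  where
  absent : ∀ u v → indicator (F u v) ≡ 0
  absent u v with F u v in Fuv
  ... | false = refl
  ... | true  = ⊥-elim (empty (u , v , Fuv))

_─_ : ∀ {n} → ArcSet n → Fin n × Fin n → ArcSet n
(F ─ (a , b)) u v = F u v ∧ not (⌊ u ≟ a ⌋ ∧ ⌊ v ≟ b ⌋)

size-─ : ∀ {n} (F : ArcSet n) {a b} → F a b ≡ true → size F ≡ suc (size (F ─ (a , b)))
size-─ F {a} {b} Fab = begin
  size F                               ≡⟨ size≡sumFin F ⟩
  sumFin (rowSize F)                   ≡⟨ sumFin-decrement a rowA otherRows ⟩
  suc (sumFin (rowSize (F ─ (a , b)))) ≡⟨ cong suc (sym (size≡sumFin (F ─ (a , b)))) ⟩
  suc (size (F ─ (a , b)))             ∎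
  where
  open ≡-Reasoning
  otherRows : ∀ u → u ≢ a → rowSize F u ≡ rowSize (F ─ (a , b)) u
  otherRows u u≢a with u ≟ a
  ... | yes u≡a = ⊥-elim (u≢a u≡a)
  ... | no _    = sumFin-cong (λ v → cong indicator (sym (Bool.∧-identityʳ (F u v))))
  rowA : rowSize F a ≡ suc (rowSize (F ─ (a , b)) a)
  rowA with a ≟ a
  ... | no a≢a = ⊥-elim (a≢a refl)
  ... | yes _  = sumFin-decrement b removed otherColumns
    where
    removed : indicator (F a b) ≡ suc (indicator (F a b ∧ not ⌊ b ≟ b ⌋))
    removed with b ≟ b
    ... | no b≢b = ⊥-elim (b≢b refl)
    ... | yes _  rewrite Fab = refl
    otherColumns : ∀ v → v ≢ b → indicator (F a v) ≡ indicator (F a v ∧ not ⌊ v ≟ b ⌋)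
    otherColumns v v≢b with v ≟ b
    ... | yes v≡b = ⊥-elim (v≢b v≡b)
    ... | no _    = cong indicator (sym (Bool.∧-identityʳ (F a v)))

─-elim : ∀ {n} {F : ArcSet n} {a b u v} →
  (F ─ (a , b)) u v ≡ true → F u v ≡ true × (u , v) ≢ (a , b)
─-elim {F = F} {a} {b} {u} {v} p with u ≟ a | v ≟ b | F u v
─-elim () | yes refl | yes refl | true
... | yes _    | no v≢b   | true = refl , λ { refl → v≢b refl }
... | no u≢a   | _        | true = refl , λ { refl → u≢a refl }

─-intro : ∀ {n} {F : ArcSet n} {a b u v} →
  F u v ≡ true → (u , v) ≢ (a , b) → (F ─ (a , b)) u v ≡ true
─-intro {F = F} {a} {b} {u} {v} Fuv uv≢ab with u ≟ a | v ≟ b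
... | yes refl | yes refl = ⊥-elim (uv≢ab refl)
... | yes _    | no _     = trans (Bool.∧-identityʳ (F u v)) Fuv
... | no _     | _        = trans (Bool.∧-identityʳ (F u v)) Fuv

record ArcInjection {n} (X Y : ArcSet n) : Set where
  field
    image     : ∀ {a b} → X a b ≡ true → Fin n × Fin n
    image∈    : ∀ {a b} (p : X a b ≡ true) → Y (proj₁ (image p)) (proj₂ (image p)) ≡ true
    injective : ∀ {a b a′ b′} (p : X a b ≡ true) (p′ : X a′ b′ ≡ true) →
                image p ≡ image p′ → (a , b) ≡ (a′ , b′)

-- Remove an arc of X together with its image, and recurse on size X.
size-≤-injection : ∀ {n} {X Y : ArcSet n} → ArcInjection X Y → size X ≤ size Y
size-≤-injection {X = X} = go (size X) refl
  where
  go : ∀ {n} k {X Y : ArcSet n} → size X ≡ k → ArcInjection X Y → size X ≤ size Y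
  go k {X} {Y} size≡k ι with any? (λ a → any? (λ b → X a b Bool.≟ true))
  ... | no empty = ≤-trans (≤-reflexive (size-empty empty)) z≤n
  ... | yes (a , b , Xab) with k
  ...   | zero   = ⊥-elim (0≢1+n (trans (sym size≡k) (size-─ X Xab)))
  ...   | suc k′ = subst₂ _≤_ (sym (size-─ X Xab)) (sym (size-─ Y (image∈ Xab)))
                     (s≤s (go k′ (suc-injective (trans (sym (size-─ X Xab)) size≡k)) ι′))
    where
    open ArcInjection ι
    ι′ : ArcInjection (X ─ (a , b)) (Y ─ image Xab)
    ι′ = record
      { image     = λ p → image (proj₁ (removed p))
      ; image∈    = λ p → let (Xuv , uv≢ab) = removed p in
                      ─-intro {F = Y} (image∈ Xuv) (λ same → uv≢ab (injective Xuv Xab same))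
      ; injective = λ p p′ → injective (proj₁ (removed p)) (proj₁ (removed p′))
      }
      where
      removed : ∀ {u v} → (X ─ (a , b)) u v ≡ true → X u v ≡ true × (u , v) ≢ (a , b)
      removed {u} {v} = ─-elim {F = X} {a} {b} {u} {v}

SCycleFree : ∀ {n} → Subset n → Digraph n → Set
SCycleFree S D = ∀ x xs → ¬ IsSCycle S D x xs

Consec-mono : ∀ {n} {D E : Digraph n} → D ⊆ᴬ E → ∀ l → Consec D l → Consec E l
Consec-mono D⊆E []          _        = tt
Consec-mono D⊆E (x ∷ [])    _        = tt
Consec-mono D⊆E (x ∷ y ∷ l) (e , es) = D⊆E x y e , Consec-mono D⊆E (y ∷ l) es

SCycleFree-anti : ∀ {n} {S : Subset n} {D E : Digraph n} → D ⊆ᴬ E → SCycleFree S E → SCycleFree S D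
SCycleFree-anti D⊆E free x xs ((distinct , closed) , inS) =
  free x xs ((distinct , Consec-mono D⊆E _ closed) , inS)

ArcOf-Consec : ∀ {n} {D : Digraph n} {a b} l → ArcOf a b l → Consec D l → D a b ≡ true
ArcOf-Consec (x ∷ y ∷ l) (inj₁ (refl , refl)) (Dxy , _) = Dxy
ArcOf-Consec (x ∷ y ∷ l) (inj₂ a→b∈l)        (_ , rest) = ArcOf-Consec (y ∷ l) a→b∈l rest

Consec-snoc : ∀ {n} {D : Digraph n} {u v w} mid →
  Consec D (u ∷ mid ++ v ∷ []) → D v w ≡ true → Consec D ((u ∷ mid ++ v ∷ []) ++ w ∷ [])
Consec-snoc []        (Duv , _)    Dvw = Duv , Dvw , tt
Consec-snoc (x ∷ mid) (Dux , rest) Dvw = Dux , Consec-snoc mid rest Dvw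

ArcOf-snoc : ∀ {n} {a b u v w : Fin n} mid → ArcOf a b ((u ∷ mid ++ v ∷ []) ++ w ∷ []) →
  ArcOf a b (u ∷ mid ++ v ∷ []) ⊎ (a ≡ v × b ≡ w)
ArcOf-snoc []        (inj₁ a→b≡u→v)        = inj₁ (inj₁ a→b≡u→v)
ArcOf-snoc []        (inj₂ (inj₁ a→b≡v→w)) = inj₂ a→b≡v→w
ArcOf-snoc (x ∷ mid) (inj₁ a→b≡u→x)        = inj₁ (inj₁ a→b≡u→x)
ArcOf-snoc (x ∷ mid) (inj₂ a→b∈rest) with ArcOf-snoc mid a→b∈rest
... | inj₁ onPath = inj₁ (inj₂ onPath)
... | inj₂ last   = inj₂ last

hitOrAvoid : ∀ {n} {D : Digraph n} (F : ArcSet n) l → Consec D l →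
  Σ (Fin n × Fin n) (λ (a , b) → ArcOf a b l × F a b ≡ true) ⊎ Consec (D ∖ᴬ F) l
hitOrAvoid F []          _          = inj₂ tt
hitOrAvoid F (x ∷ [])    _          = inj₂ tt
hitOrAvoid F (x ∷ y ∷ l) (Dxy , rest) with F x y in Fxy | hitOrAvoid F (y ∷ l) rest
... | true  | _                                = inj₁ ((x , y) , inj₁ (refl , refl) , Fxy)
... | false | inj₁ ((a , b) , a→b∈l , Fab)     = inj₁ ((a , b) , inj₂ a→b∈l , Fab)
... | false | inj₂ avoids                     = inj₂ (trans (Bool.∧-identityʳ _) Dxy , avoids)

IsSFAS-cong : ∀ {n} {S : Subset n} {D : Digraph n} {F G : ArcSet n} →
  (∀ u v → F u v ≡ G u v) → IsSFAS S D F → IsSFAS S D G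
IsSFAS-cong {D = D} F≗G (F⊆D , free) =
  (λ u v Guv → F⊆D u v (trans (F≗G u v) Guv)) ,
  SCycleFree-anti (λ u v p → subst (λ b → D u v ∧ not b ≡ true) (sym (F≗G u v)) p) free

IsSFAS-restrict : ∀ {n} {S : Subset n} {D X : Digraph n} {F : ArcSet n} →
  X ⊆ᴬ D → IsSFAS S D F → IsSFAS S X (λ u v → F u v ∧ X u v)
IsSFAS-restrict {D = D} {X} {F} X⊆D (_ , free) =
  (λ u v → Bool.∧-conicalʳ _ _) , SCycleFree-anti kept free
  where
  kept : (X ∖ᴬ (λ u v → F u v ∧ X u v)) ⊆ᴬ (D ∖ᴬ F)
  kept u v p with X u v in Xuv | F u v
  ... | true | false = trans (Bool.∧-identityʳ (D u v)) (X⊆D u v Xuv)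

Consec? : ∀ {n} (D : Digraph n) l → Dec (Consec D l)
Consec? D []          = yes tt
Consec? D (x ∷ [])    = yes tt
Consec? D (x ∷ y ∷ l) = (D x y Bool.≟ true) ×-dec Consec? D (y ∷ l)

IsSCycle? : ∀ {n} (S : Subset n) (D : Digraph n) x xs → Dec (IsSCycle S D x xs)
IsSCycle? S D x xs =
  (UniqueDec.unique? _≟_ (x ∷ xs) ×-dec Consec? D _) ×-dec Any.any? (_∈? S) (x ∷ xs)

AllPairs-lookup : ∀ {A : Set} {R : A → A → Set} {l : List A} → AllPairs R l →
  ∀ {i j} → i <ᶠ j → R (List.lookup l i) (List.lookup l j)
AllPairs-lookup (r ∷ _)  {zero}  {suc j} _         = All.lookup r (∈-lookup j)
AllPairs-lookup (_ ∷ rs) {suc i} {suc j} (s≤s i<j) = AllPairs-lookup rs i<j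

Unique⇒length≤ : ∀ {n} (l : List (Fin n)) → Unique l → length l ≤ n
Unique⇒length≤ {n} l distinct with length l ≤? n
... | yes l≤n = l≤n
... | no  l≰n with pigeonhole (≰⇒> l≰n) (List.lookup l)
...   | i , j , i<j , same = ⊥-elim (AllPairs-lookup distinct i<j same)

anyList≤? : ∀ {n} N {P : List (Fin n) → Set} → (∀ xs → Dec (P xs)) →
  Dec (∃ λ xs → length xs ≤ N × P xs)
anyList≤? N P? with P? []
... | yes P[] = yes ([] , z≤n , P[])
anyList≤? zero    P? | no ¬P[] = no λ { ([] , _ , P[]) → ¬P[] P[] }
anyList≤? (suc N) P? | no ¬P[] = map′
  (λ (x , xs , len≤ , Pxs) → x ∷ xs , s≤s len≤ , Pxs)
  (λ { ([] , _ , P[]) → ⊥-elim (¬P[] P[]) ; (x ∷ xs , s≤s len≤ , Pxs) → x , xs , len≤ , Pxs })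
  (any? (λ x → anyList≤? N (P? ∘ (x ∷_))))

hasSCycle? : ∀ {n} (S : Subset n) (D : Digraph n) → Dec (∃ λ x → ∃ λ xs → IsSCycle S D x xs)
hasSCycle? {n} S D = any? λ x → map′
  (λ (xs , _ , cycle) → xs , cycle)
  (λ (xs , cycle) → xs , cycleLength x xs cycle , cycle)
  (anyList≤? n (IsSCycle? S D x))
  where
  cycleLength : ∀ x xs → IsSCycle S D x xs → length xs ≤ n
  cycleLength x xs ((distinct , _) , _) = ≤-trans (n≤1+n _) (Unique⇒length≤ (x ∷ xs) distinct)

IsSFAS? : ∀ {n} (S : Subset n) (D : Digraph n) F → Dec (IsSFAS S D F)
IsSFAS? S D F =
  all? (λ u → all? (λ v → (F u v Bool.≟ true) →-dec (D u v Bool.≟ true)))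
  ×-dec map′ (λ noCycle x xs cycle → noCycle (x , xs , cycle)) (λ free (x , xs , cycle) → free x xs cycle)
             (¬? (hasSCycle? S (D ∖ᴬ F)))

-- Arc sets of Fin n are searched as subsets of Fin (n * n).
anyArcSet? : ∀ {n} {P : ArcSet n → Set} →
  (∀ {F G} → (∀ u v → F u v ≡ G u v) → P F → P G) → (∀ F → Dec (P F)) → Dec (∃ P)
anyArcSet? {n} {P} resp P? = map′
  (λ (s , Ps) → fromSubset s , Ps)
  (λ (F , PF) → toSubset F , resp (λ u v → sym (fromSubset-toSubset F u v)) PF)
  (anySubset? (P? ∘ fromSubset))
  where
  fromSubset : Subset (n * n) → ArcSet n
  fromSubset s u v = lookup s (combine u v)
  toSubset : ArcSet n → Subset (n * n)
  toSubset F = tabulate (uncurry F ∘ remQuot n)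
  fromSubset-toSubset : ∀ F u v → fromSubset (toSubset F) u v ≡ F u v
  fromSubset-toSubset F u v =
    trans (lookup∘tabulate (uncurry F ∘ remQuot n) (combine u v)) (cong (uncurry F) (remQuot-combine u v))

IsSFAS-full : ∀ {n} (S : Subset n) (D : Digraph n) → IsSFAS S D D
IsSFAS-full S D = (λ _ _ Duv → Duv) , λ { x [] ((_ , (e , _)) , _) → noArc x x e
                                         ; x (y ∷ _) ((_ , (e , _)) , _) → noArc x y e }
  where
  noArc : ∀ u v → (D ∖ᴬ D) u v ≢ true
  noArc u v with D u v
  ... | true  = λ ()
  ... | false = λ ()

-- Descend from D while a strictly smaller S-feedback arc set exists, which is decidable.
minimumSFAS : ∀ {n} (S : Subset n) (D : Digraph n) → Σ (ArcSet n) (IsMinSFAS S D)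
minimumSFAS S D = descend D (IsSFAS-full S D) (<-wellFounded (size D))
  where
  descend : ∀ F → IsSFAS S D F → Acc _<_ (size F) → Σ (ArcSet _) (IsMinSFAS S D)
  descend F isF (acc smaller)
    with anyArcSet? smallerSFAS-cong (λ G → IsSFAS? S D G ×-dec (size G <? size F))
    where
    smallerSFAS-cong : ∀ {G H} → (∀ u v → G u v ≡ H u v) →
      IsSFAS S D G × size G < size F → IsSFAS S D H × size H < size F
    smallerSFAS-cong G≗H (isG , G<F) = IsSFAS-cong G≗H isG , subst (_< size F) (size-cong G≗H) G<F
  ... | yes (G , isG , G<F) = descend G isG (smaller G<F)
  ... | no none = F , isF , λ G isG → ≮⇒≥ (λ G<F → none (G , isG , G<F))

module _ {n ℓ} (T : Tournament n) (σ : Permutation′ n) (S : Subset n) (P : OrderedPartition σ ℓ) where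

  private
    A_I A_B : ArcSet n
    A_I = AI T σ P
    A_B = AB T σ P

  BE? : ∀ v u → Dec (BE T σ P v u)
  BE? v u = (A_B v u Bool.≟ true) ×-dec (pos σ u <ᶠ? pos σ v)

  backwardArcs : ArcSet n
  backwardArcs v u = ⌊ BE? v u ⌋

  AI⊆adj : A_I ⊆ᴬ adj T
  AI⊆adj u v = Bool.∧-conicalˡ _ _

  AB⊆adj : A_B ⊆ᴬ adj T
  AB⊆adj u v = Bool.∧-conicalˡ _ _

  size-split : ∀ F → size (λ u v → F u v ∧ A_I u v) + size (λ u v → F u v ∧ A_B u v) ≤ size F
  size-split F = size-+-≤ (λ u v → split (F u v) (adj T u v) ⌊ part P u ≟ part P v ⌋)
    where
    split : ∀ f a e → indicator (f ∧ (a ∧ e)) + indicator (f ∧ (a ∧ not e)) ≤ indicator f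
    split true  true  true  = ≤-refl
    split true  true  false = ≤-refl
    split true  false e     = z≤n
    split false a     e     = z≤n

  Sfas-superadditive : ∀ {F FI FB} → IsSFAS S (adj T) F → IsMinSFAS S A_I FI → IsMinSFAS S A_B FB →
    size FI + size FB ≤ size F
  Sfas-superadditive {F} isF (_ , FI-min) (_ , FB-min) = ≤-trans
    (+-mono-≤ (FI-min _ (IsSFAS-restrict AI⊆adj isF)) (FB-min _ (IsSFAS-restrict AB⊆adj isF)))
    (size-split F)

  module _ (FI : ArcSet n) where

    private
      Remaining : Digraph n
      Remaining = adj T ∖ᴬ (λ u v → FI u v ∨ backwardArcs u v)

    remainingArc : ∀ a b → Remaining a b ≡ true →
      part P a ≤ᶠ part P b × (part P a ≡ part P b → (A_I ∖ᴬ FI) a b ≡ true)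
    remainingArc a b p with ∧-not-∨ (adj T a b) (FI a b) (backwardArcs a b) p
    ... | adjab , FIab , notBackward = classify (part P a ≟ part P b)
      where
      classify : Dec (part P a ≡ part P b) →
        part P a ≤ᶠ part P b × (part P a ≡ part P b → (A_I ∖ᴬ FI) a b ≡ true)
      classify (yes same) = ≤ᶠ-reflexive same ,
        λ _ → cong₂ _∧_ (cong₂ _∧_ adjab (⌊⌋-yes (part P a ≟ part P b) same)) (cong not FIab)
      classify (no diff) = ordered P a b (≮⇒≥ backward) , λ same → ⊥-elim (diff same)
        where
        inAB : A_B a b ≡ true
        inAB = cong₂ _∧_ adjab (cong not (⌊⌋-no (part P a ≟ part P b) diff))
        backward : ¬ (pos σ b <ᶠ pos σ a)
        backward b<a with trans (sym (⌊⌋-yes (BE? a b) (inAB , b<a))) notBackward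
        ... | ()

    part-mono : ∀ y ys z → Consec Remaining (y ∷ ys ++ z ∷ []) → part P y ≤ᶠ part P z
    part-mono y []       z (Ryz , _)    = proj₁ (remainingArc y z Ryz)
    part-mono y (w ∷ ws) z (Ryw , rest) = ≤ᶠ-trans (proj₁ (remainingArc y w Ryw)) (part-mono w ws z rest)

    -- Parts never decrease along Remaining, so a walk returning to its starting part stays inside it.
    insidePart : ∀ y ys z → Consec Remaining (y ∷ ys ++ z ∷ []) → part P y ≡ part P z →
      Consec (A_I ∖ᴬ FI) (y ∷ ys ++ z ∷ [])
    insidePart y []       z (Ryz , _)    same = proj₂ (remainingArc y z Ryz) same , tt
    insidePart y (w ∷ ws) z (Ryw , rest) same =
      proj₂ (remainingArc y w Ryw) y≡w , insidePart w ws z rest (trans (sym y≡w) same)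
      where
      y≡w : part P y ≡ part P w
      y≡w = ≤ᶠ-antisym (proj₁ (remainingArc y w Ryw))
                       (≤ᶠ-trans (part-mono w ws z rest) (≤ᶠ-reflexive (sym same)))

    IsSFAS-addBackward : IsSFAS S A_I FI → IsSFAS S (adj T) (λ u v → FI u v ∨ backwardArcs u v)
    IsSFAS-addBackward (FI⊆AI , free) = deleted⊆adj , λ x xs ((distinct , closed) , inS) →
      free x xs ((distinct , insidePart x xs x closed refl) , inS)
      where
      deleted⊆adj : (λ u v → FI u v ∨ backwardArcs u v) ⊆ᴬ adj T
      deleted⊆adj u v p with FI u v in FIuv
      ... | true  = AI⊆adj u v (FI⊆AI u v FIuv)
      ... | false = AB⊆adj u v (proj₁ (⌊⌋-true (BE? u v) p))

  module _ (safe : SSafe T σ P S) where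

    private
      cert = proj₁ safe
      certificates = proj₁ (proj₂ safe)
      disjoint = proj₂ (proj₂ safe)

      certificatePath : ∀ v u → BE T σ P v u → List (Fin n)
      certificatePath v u f = u ∷ cert v u f ++ v ∷ []

    forward⊆AB : ABforward T σ P ⊆ᴬ A_B
    forward⊆AB u v = Bool.∧-conicalˡ _ _

    forward-pos : ∀ {a b} → ABforward T σ P a b ≡ true → pos σ a <ᶠ pos σ b
    forward-pos {a} {b} p = ⌊⌋-true (pos σ a <ᶠ? pos σ b) (Bool.∧-conicalʳ _ _ p)

    certificatePath-forward : ∀ {v u a b} f → ArcOf a b (certificatePath v u f) → pos σ a <ᶠ pos σ b
    certificatePath-forward {v} {u} f onPath =
      forward-pos (ArcOf-Consec _ onPath (proj₁ (proj₂ (certificates v u f))))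

    certificateCycle : ∀ v u (f : BE T σ P v u) → IsSCycle S A_B u (cert v u f ++ v ∷ [])
    certificateCycle v u f with certificates v u f
    ... | distinct , forward , inS =
      (distinct , Consec-snoc (cert v u f) (Consec-mono forward⊆AB _ forward) (proj₁ f)) , inS

    Hits : ArcSet n → ∀ v u → BE T σ P v u → Fin n × Fin n → Set
    Hits F v u f (a , b) = (ArcOf a b (certificatePath v u f) ⊎ (a ≡ v × b ≡ u)) × F a b ≡ true

    hitArc : ∀ {F} → SCycleFree S (A_B ∖ᴬ F) → ∀ v u f → Σ (Fin n × Fin n) (Hits F v u f)
    hitArc {F} free v u f with certificateCycle v u f
    ... | (distinct , closed) , inS with hitOrAvoid F _ closed
    ...   | inj₁ ((a , b) , onCycle , Fab) = (a , b) , ArcOf-snoc (cert v u f) onCycle , Fab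
    ...   | inj₂ avoids                    = ⊥-elim (free u _ ((distinct , avoids) , inS))

    -- Certificate arcs are forward and pairwise distinct, the closing arcs are backward.
    hitArc-injective : ∀ {F v u v′ u′ a b} f f′ → Hits F v u f (a , b) → Hits F v′ u′ f′ (a , b) →
      (v , u) ≡ (v′ , u′)
    hitArc-injective f f′ (inj₂ (refl , refl) , _) (inj₂ (refl , refl) , _) = refl
    hitArc-injective f f′ (inj₁ onPath , _) (inj₂ (refl , refl) , _) =
      ⊥-elim (<-asym (certificatePath-forward f onPath) (proj₂ f′))
    hitArc-injective f f′ (inj₂ (refl , refl) , _) (inj₁ onPath′ , _) =
      ⊥-elim (<-asym (certificatePath-forward f′ onPath′) (proj₂ f))
    hitArc-injective {v = v} {u} {v′} {u′} {a} {b} f f′ (inj₁ onPath , _) (inj₁ onPath′ , _)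
      with ≡-dec _≟_ _≟_ (v , u) (v′ , u′)
    ... | yes same  = same
    ... | no differ =
      ⊥-elim (disjoint v u v′ u′ f f′ (λ (p , q) → differ (cong₂ _,_ p q)) a b onPath onPath′)

    size-backward≤ : ∀ {F} → IsSFAS S A_B F → size backwardArcs ≤ size F
    size-backward≤ {F} (_ , free) = size-≤-injection record
      { image     = λ p → proj₁ (hitFrom p)
      ; image∈    = λ p → proj₂ (proj₂ (hitFrom p))
      ; injective = λ p p′ same →
          hitArc-injective {F} _ _ (proj₂ (hitFrom p))
            (subst (Hits F _ _ _) (sym same) (proj₂ (hitFrom p′)))
      }
      where
      hitFrom : ∀ {v u} (p : backwardArcs v u ≡ true) →
        Σ (Fin n × Fin n) (Hits F v u (⌊⌋-true (BE? v u) p))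
      hitFrom {v} {u} p = hitArc free v u (⌊⌋-true (BE? v u) p)

    size-addBackward≤ : ∀ {FI FB} → IsSFAS S A_B FB →
      size (λ u v → FI u v ∨ backwardArcs u v) ≤ size FI + size FB
    size-addBackward≤ {FI} isFB =
      ≤-trans (size-∨ FI backwardArcs) (+-monoʳ-≤ (size FI) (size-backward≤ isFB))

    Sfas-additive : ∀ {a b c} → SfasIs S (adj T) a → SfasIs S A_I b → SfasIs S A_B c → a ≡ b + c
    Sfas-additive (FA , (isFA , FA-min) , refl) (FI , FI-isMin , refl) (FB , FB-isMin , refl) = ≤-antisym
      (≤-trans (FA-min _ (IsSFAS-addBackward FI (proj₁ FI-isMin))) (size-addBackward≤ (proj₁ FB-isMin)))
      (Sfas-superadditive isFA FI-isMin FB-isMin)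

    minSFAS⊇backward :
      Σ (ArcSet n) λ F → IsMinSFAS S (adj T) F × (∀ v u → BE T σ P v u → F v u ≡ true)
    minSFAS⊇backward = G , (IsSFAS-addBackward FI (proj₁ FI-isMin) , G-min) , G⊇backward
      where
      FI = proj₁ (minimumSFAS S A_I)
      FI-isMin = proj₂ (minimumSFAS S A_I)
      FB-isMin = proj₂ (minimumSFAS S A_B)
      G : ArcSet n
      G u v = FI u v ∨ backwardArcs u v
      G-min : ∀ F → IsSFAS S (adj T) F → size G ≤ size F
      G-min F isF =
        ≤-trans (size-addBackward≤ (proj₁ FB-isMin)) (Sfas-superadditive isF FI-isMin FB-isMin)
      G⊇backward : ∀ v u → BE T σ P v u → G v u ≡ true
      G⊇backward v u f = trans (cong (FI v u ∨_) (⌊⌋-yes (BE? v u) f)) (Bool.∨-zeroʳ (FI v u))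

mainTheorem6 : ∀ {n ℓ : ℕ} (T : Tournament n) (σ : Permutation′ n)
    (S : Subset n) (P : OrderedPartition σ ℓ) →
    SSafe T σ P S →
    (∀ a b c → SfasIs S (adj T) a → SfasIs S (AI T σ P) b →
      SfasIs S (AB T σ P) c → a ≡ b + c)
    × Σ (ArcSet n) (λ F → IsMinSFAS S (adj T) F
        × (∀ v u → BE T σ P v u → F v u ≡ true))
mainTheorem6 T σ S P safe =
  (λ _ _ _ → Sfas-additive T σ S P safe) , minSFAS⊇backward T σ S P safe
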